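{- Let $T$ be a hemi-Nelson algebra. Then for all $x,y,z\in T$, $$(x\rightarrow y)\vee(z\wedge\sim z)=(x\vee(z\wedge\sim z))\rightarrow(y\vee(z\wedge\sim z)).$$
   Context: A Kleene algebra is a bounded distributive lattice $\langle T,\wedge,\vee,0,1\rangle$ with a unary operation $\sim$ such that $\sim\sim x=x$, $\sim(x\wedge y)=\sim x\vee\sim y$ and $(x\wedge\sim x)\wedge(y\vee\sim y)=x\wedge\sim x$. A hemi-Nelson algebra is an algebra $\langle T,\wedge,\vee,\rightarrow,\sim,0,1\rangle$ of type $(2,2,2,1,0,0)$ such that $\langle T,\wedge,\vee,\sim,0,1\rangle$ is a Kleene algebra and for all $x,y,z\in T$: (hN1) $x\rightarrow x=1$; (hN2) $x\wedge(x\rightarrow y)\le x\wedge(\sim x\vee y)$; (hN3) $\sim(x\rightarrow y)\rightarrow(x\wedge\sim y)=1$; (hN4) $(x\wedge\sim y)\rightarrow\sim(x\rightarrow y)=1$; (hN5) $(x\wedge y\wedge(x\rightarrow y))\rightarrow(x\wedge(x\rightarrow y))=1$; (hN6) $(x\wedge(x\rightarrow y))\rightarrow(x\wedge y\wedge(x\rightarrow y))=1$; (hN7) if $x\rightarrow y=1$, $y\rightarrow x=1$, $y\rightarrow z=1$ and $z\rightarrow y=1$ then $x\rightarrow z=1$ and $z\rightarrow x=1$; (hN8) if $x\rightarrow y=1$ and $y\rightarrow x=1$ then $(x\wedge z)\rightarrow(y\wedge z)=1$; (hN9) if $x\rightarrow y=1$ and $y\rightarrow x=1$ then $(x\vee z)\rightarrow(y\vee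 z)=1$; (hN10) if $x\rightarrow y=1$ and $y\rightarrow x=1$ then $(x\rightarrow z)\rightarrow(y\rightarrow z)=1$ and $(z\rightarrow x)\rightarrow(z\rightarrow y)=1$. -}

module Defs where

open import Level using (Level; suc)
open import Relation.Binary.PropositionalEquality using (_≡_)
open import Algebra.Core using (Op₁; Op₂)
open import Algebra.Definitions using (Identity)
open import Algebra.Lattice.Structures using (IsDistributiveLattice)
open import Data.Product using (_×_)

record HemiNelsonAlgebra (ℓ : Level) : Set (suc ℓ) where
  infixr 5 _⇒_
  infixr 6 _∨_
  infixr 7 _∧_
  field
    T    : Set ℓ
    _∧_  : Op₂ T
    _∨_  : Op₂ T
    _⇒_  : Op₂ T
    ∼    : Op₁ T
    𝟘    : T
    𝟙    : T
    isDistributiveLattice : IsDistributiveLattice {A = T} _≡_ _∨_ _∧_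
    ∨-identity : Identity _≡_ 𝟘 _∨_
    ∧-identity : Identity _≡_ 𝟙 _∧_
    ∼-invol   : ∀ x → ∼ (∼ x) ≡ x
    ∼-deMorgan : ∀ x y → ∼ (x ∧ y) ≡ ∼ x ∨ ∼ y
    kleene    : ∀ x y → (x ∧ ∼ x) ∧ (y ∨ ∼ y) ≡ x ∧ ∼ x

  infix 4 _≤_
  _≤_ : T → T → Set ℓ
  x ≤ y = x ∧ y ≡ x

  field
    hN1 : ∀ x → x ⇒ x ≡ 𝟙
    hN2 : ∀ x y → x ∧ (x ⇒ y) ≤ x ∧ (∼ x ∨ y)
    hN3 : ∀ x y → ∼ (x ⇒ y) ⇒ (x ∧ ∼ y) ≡ 𝟙
    hN4 : ∀ x y → (x ∧ ∼ y) ⇒ ∼ (x ⇒ y) ≡ 𝟙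
    hN5 : ∀ x y → (x ∧ y ∧ (x ⇒ y)) ⇒ (x ∧ (x ⇒ y)) ≡ 𝟙
    hN6 : ∀ x y → (x ∧ (x ⇒ y)) ⇒ (x ∧ y ∧ (x ⇒ y)) ≡ 𝟙
    hN7 : ∀ x y z → x ⇒ y ≡ 𝟙 → y ⇒ x ≡ 𝟙 → y ⇒ z ≡ 𝟙 → z ⇒ y ≡ 𝟙
          → (x ⇒ z ≡ 𝟙) × (z ⇒ x ≡ 𝟙)
    hN8 : ∀ x y z → x ⇒ y ≡ 𝟙 → y ⇒ x ≡ 𝟙 → (x ∧ z) ⇒ (y ∧ z) ≡ 𝟙
    hN9 : ∀ x y z → x ⇒ y ≡ 𝟙 → y ⇒ x ≡ 𝟙 → (x ∨ z) ⇒ (y ∨ z) ≡ 𝟙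
    hN10 : ∀ x y z → x ⇒ y ≡ 𝟙 → y ⇒ x ≡ 𝟙
           → ((x ⇒ z) ⇒ (y ⇒ z) ≡ 𝟙) × ((z ⇒ x) ⇒ (z ⇒ y) ≡ 𝟙)

-- Write x ⇔ y when x ⇒ y = 1 and y ⇒ x = 1. By hN1 and hN7–hN10 this is a
-- congruence for ∧, ∨ and ⇒, and by hN2 together with the Kleene law, x ⇔ y and
-- ∼ x ⇔ ∼ y force x = y. With c = z ∧ ∼ z we have c ⇔ ∼ (z ⇒ z) = ∼ 1 = 0, so
-- both sides of the identity are ⇔-related to x ⇒ y, and by hN3–hN4 their
-- negations are both ⇔-related to x ∧ ∼ y ∧ ∼ c.
module Submission where

open import Level using (Level)
open import Relation.Binary.PropositionalEquality using (_≡_)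
open import Defs

open import Algebra.Core using (Op₁)
open import Algebra.Definitions using (Congruent₁; Involutive)
open import Algebra.Lattice.Bundles using (DistributiveLattice)
import Algebra.Lattice.Properties.Lattice as LatticeProperties
open import Data.Product using (_×_; _,_; proj₁; proj₂; swap)
open import Relation.Binary.Bundles using (Setoid)
open import Relation.Binary.Core using (Rel)
open import Relation.Binary.Structures using (IsEquivalence)
import Relation.Binary.Lattice as OrderTheoretic
import Relation.Binary.PropositionalEquality as ≡
import Relation.Binary.Reasoning.PartialOrder as ≤-Reasoning
import Relation.Binary.Reasoning.Setoid as SetoidReasoning

module KleeneAlgebra {c ℓ} (L : DistributiveLattice c ℓ) where
  open DistributiveLattice L

  module Properties
    {∼ : Op₁ Carrier}
    (∼-cong : Congruent₁ _≈_ ∼)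
    (∼-involutive : Involutive _≈_ ∼)
    (∼-deMorgan : ∀ x y → ∼ (x ∧ y) ≈ ∼ x ∨ ∼ y)
    (kleene : ∀ x y → (x ∧ ∼ x) ∧ (y ∨ ∼ y) ≈ x ∧ ∼ x)
    where

    open OrderTheoretic.Lattice (LatticeProperties.∨-∧-orderTheoreticLattice lattice) public
      using (_≤_; poset; antisym; y≤x∨y; ∨-least; x∧y≤x; x∧y≤y; ∧-greatest)
      renaming (refl to ≤-refl; trans to ≤-trans)
    open ≤-Reasoning poset

    ∼-∨-deMorgan : ∀ x y → ∼ (x ∨ y) ≈ ∼ x ∧ ∼ y
    ∼-∨-deMorgan x y = begin-equality
      ∼ (x ∨ y)             ≈⟨ ∼-cong (∨-cong (∼-involutive x) (∼-involutive y)) ⟨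
      ∼ (∼ (∼ x) ∨ ∼ (∼ y)) ≈⟨ ∼-cong (∼-deMorgan (∼ x) (∼ y)) ⟨
      ∼ (∼ (∼ x ∧ ∼ y))     ≈⟨ ∼-involutive (∼ x ∧ ∼ y) ⟩
      ∼ x ∧ ∼ y             ∎

    ∼-antitone : ∀ {x y} → x ≤ y → ∼ y ≤ ∼ x
    ∼-antitone {x} {y} x≤y = begin
      ∼ y       ≤⟨ y≤x∨y (∼ x) (∼ y) ⟩
      ∼ x ∨ ∼ y ≈⟨ ∼-deMorgan x y ⟨
      ∼ (x ∧ y) ≈⟨ ∼-cong x≤y ⟨
      ∼ x       ∎

    ≤-from-∼∨ : ∀ {x y} → x ≤ ∼ x ∨ y → ∼ y ≤ y ∨ ∼ x → x ≤ y
    ≤-from-∼∨ {x} {y} x≤∼x∨y ∼y≤y∨∼x = begin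
      x                     ≤⟨ ∧-greatest ≤-refl x≤∼x∨y ⟩
      x ∧ (∼ x ∨ y)         ≈⟨ ∧-distribˡ-∨ x (∼ x) y ⟩
      (x ∧ ∼ x) ∨ (x ∧ y)   ≤⟨ ∨-least x∧∼x≤y (x∧y≤y x y) ⟩
      y                     ∎
      where
      x∧∼y≤y : x ∧ ∼ y ≤ y
      x∧∼y≤y = begin
        x ∧ ∼ y        ≈⟨ ∧-comm x (∼ y) ⟩
        ∼ y ∧ x        ≈⟨ ∧-congˡ (∼-involutive x) ⟨
        ∼ y ∧ ∼ (∼ x)  ≈⟨ ∼-∨-deMorgan y (∼ x) ⟨
        ∼ (y ∨ ∼ x)    ≤⟨ ∼-antitone ∼y≤y∨∼x ⟩
        ∼ (∼ y)        ≈⟨ ∼-involutive y ⟩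
        y              ∎

      x∧∼x≤y : x ∧ ∼ x ≤ y
      x∧∼x≤y = begin
        x ∧ ∼ x                                ≈⟨ kleene x y ⟨
        (x ∧ ∼ x) ∧ (y ∨ ∼ y)                  ≈⟨ ∧-distribˡ-∨ (x ∧ ∼ x) y (∼ y) ⟩
        ((x ∧ ∼ x) ∧ y) ∨ ((x ∧ ∼ x) ∧ ∼ y)    ≤⟨ ∨-least (x∧y≤y _ y) (≤-trans x∧∼x∧∼y≤x∧∼y x∧∼y≤y) ⟩
        y                                      ∎
        where
        x∧∼x∧∼y≤x∧∼y : (x ∧ ∼ x) ∧ ∼ y ≤ x ∧ ∼ y
        x∧∼x∧∼y≤x∧∼y = ∧-greatest (≤-trans (x∧y≤x _ _) (x∧y≤x x (∼ x))) (x∧y≤y _ (∼ y))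

module HemiNelsonAlgebraProperties {ℓ : Level} (A : HemiNelsonAlgebra ℓ) where
  open HemiNelsonAlgebra A hiding (_≤_)

  distributiveLattice : DistributiveLattice ℓ ℓ
  distributiveLattice = record { isDistributiveLattice = isDistributiveLattice }

  open KleeneAlgebra.Properties distributiveLattice (≡.cong ∼) ∼-invol ∼-deMorgan kleene public
  open DistributiveLattice distributiveLattice using (∨-comm)

  ∼𝟙≡𝟘 : ∼ 𝟙 ≡ 𝟘
  ∼𝟙≡𝟘 = begin
    ∼ 𝟙                ≡⟨ proj₂ ∨-identity (∼ 𝟙) ⟨
    ∼ 𝟙 ∨ 𝟘            ≡⟨ ≡.cong (∼ 𝟙 ∨_) (∼-invol 𝟘) ⟨
    ∼ 𝟙 ∨ ∼ (∼ 𝟘)      ≡⟨ ∼-deMorgan 𝟙 (∼ 𝟘) ⟨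
    ∼ (𝟙 ∧ ∼ 𝟘)        ≡⟨ ≡.cong ∼ (proj₁ ∧-identity (∼ 𝟘)) ⟩
    ∼ (∼ 𝟘)            ≡⟨ ∼-invol 𝟘 ⟩
    𝟘                  ∎
    where open ≡.≡-Reasoning

  -- The order of the record, used in hN2, is x ∧ y ≡ x; that of the library
  -- lattice is x ≡ x ∧ y.
  ⇒≡𝟙⇒≤∼∨ : ∀ {x y} → x ⇒ y ≡ 𝟙 → x ≤ ∼ x ∨ y
  ⇒≡𝟙⇒≤∼∨ {x} {y} x⇒y≡𝟙 = begin
    x              ≡⟨ proj₂ ∧-identity x ⟨
    x ∧ 𝟙          ≡⟨ ≡.cong (x ∧_) x⇒y≡𝟙 ⟨
    x ∧ (x ⇒ y)    ≤⟨ ≡.sym (hN2 x y) ⟩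
    x ∧ (∼ x ∨ y)  ≤⟨ x∧y≤y x (∼ x ∨ y) ⟩
    ∼ x ∨ y        ∎
    where open ≤-Reasoning poset

  infix 4 _⇔_
  _⇔_ : Rel T ℓ
  x ⇔ y = (x ⇒ y ≡ 𝟙) × (y ⇒ x ≡ 𝟙)

  ⇔-isEquivalence : IsEquivalence _⇔_
  ⇔-isEquivalence = record
    { refl  = λ {x} → hN1 x , hN1 x
    ; sym   = swap
    ; trans = λ {x} {y} {z} (x⇒y , y⇒x) (y⇒z , z⇒y) → hN7 x y z x⇒y y⇒x y⇒z z⇒y
    }

  ⇔-setoid : Setoid ℓ ℓ
  ⇔-setoid = record { isEquivalence = ⇔-isEquivalence }

  ∧-congʳ-⇔ : ∀ {x y} z → x ⇔ y → x ∧ z ⇔ y ∧ z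
  ∧-congʳ-⇔ {x} {y} z (x⇒y , y⇒x) = hN8 x y z x⇒y y⇒x , hN8 y x z y⇒x x⇒y

  ∨-congˡ-⇔ : ∀ {x y} z → x ⇔ y → z ∨ x ⇔ z ∨ y
  ∨-congˡ-⇔ {x} {y} z (x⇒y , y⇒x) =
    ≡.subst₂ _⇔_ (∨-comm x z) (∨-comm y z) (hN9 x y z x⇒y y⇒x , hN9 y x z y⇒x x⇒y)

  ⇒-cong-⇔ : ∀ {x y u v} → x ⇔ y → u ⇔ v → x ⇒ u ⇔ y ⇒ v
  ⇒-cong-⇔ {x} {y} {u} {v} (x⇒y , y⇒x) (u⇒v , v⇒u) = begin
    x ⇒ u  ≈⟨ proj₁ (hN10 x y u x⇒y y⇒x) , proj₁ (hN10 y x u y⇒x x⇒y) ⟩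
    y ⇒ u  ≈⟨ proj₂ (hN10 u v y u⇒v v⇒u) , proj₂ (hN10 v u y v⇒u u⇒v) ⟩
    y ⇒ v  ∎
    where open SetoidReasoning ⇔-setoid

  ∼⇒⇔∧∼ : ∀ x y → ∼ (x ⇒ y) ⇔ x ∧ ∼ y
  ∼⇒⇔∧∼ x y = hN3 x y , hN4 x y

  ⇔∧∼⇔⇒≡ : ∀ {x y} → x ⇔ y → ∼ x ⇔ ∼ y → x ≡ y
  ⇔∧∼⇔⇒≡ (x⇒y , y⇒x) (∼x⇒∼y , ∼y⇒∼x) =
    antisym (≤-from-⇒ x⇒y ∼y⇒∼x) (≤-from-⇒ y⇒x ∼x⇒∼y)
    where
    ≤-from-⇒ : ∀ {a b} → a ⇒ b ≡ 𝟙 → ∼ b ⇒ ∼ a ≡ 𝟙 → a ≤ b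
    ≤-from-⇒ {a} {b} a⇒b ∼b⇒∼a =
      ≤-from-∼∨ (⇒≡𝟙⇒≤∼∨ a⇒b) (≡.subst (λ w → ∼ b ≤ w ∨ ∼ a) (∼-invol b) (⇒≡𝟙⇒≤∼∨ ∼b⇒∼a))

  ∧∼⇔𝟘 : ∀ z → z ∧ ∼ z ⇔ 𝟘
  ∧∼⇔𝟘 z = begin
    z ∧ ∼ z    ≈⟨ ∼⇒⇔∧∼ z z ⟨
    ∼ (z ⇒ z)  ≡⟨ ≡.cong ∼ (hN1 z) ⟩
    ∼ 𝟙        ≡⟨ ∼𝟙≡𝟘 ⟩
    𝟘          ∎
    where open SetoidReasoning ⇔-setoid

  ∨-∧∼⇔ : ∀ x z → x ∨ (z ∧ ∼ z) ⇔ x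
  ∨-∧∼⇔ x z = begin
    x ∨ (z ∧ ∼ z)  ≈⟨ ∨-congˡ-⇔ x (∧∼⇔𝟘 z) ⟩
    x ∨ 𝟘          ≡⟨ proj₂ ∨-identity x ⟩
    x              ∎
    where open SetoidReasoning ⇔-setoid

proposition12 : ∀ {ℓ : Level} (A : HemiNelsonAlgebra ℓ) → let open HemiNelsonAlgebra A in
    ∀ (x y z : T) → (x ⇒ y) ∨ (z ∧ ∼ z) ≡ (x ∨ (z ∧ ∼ z)) ⇒ (y ∨ (z ∧ ∼ z))
proposition12 A x y z = ⇔∧∼⇔⇒≡ sides⇔ negations⇔
  where
  open HemiNelsonAlgebra A hiding (_≤_)
  open HemiNelsonAlgebraProperties A
  open DistributiveLattice distributiveLattice using (∧-assoc)
  open SetoidReasoning ⇔-setoid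

  c : T
  c = z ∧ ∼ z

  sides⇔ : (x ⇒ y) ∨ c ⇔ (x ∨ c) ⇒ (y ∨ c)
  sides⇔ = begin
    (x ⇒ y) ∨ c        ≈⟨ ∨-∧∼⇔ (x ⇒ y) z ⟩
    x ⇒ y              ≈⟨ ⇒-cong-⇔ (∨-∧∼⇔ x z) (∨-∧∼⇔ y z) ⟨
    (x ∨ c) ⇒ (y ∨ c)  ∎

  negations⇔ : ∼ ((x ⇒ y) ∨ c) ⇔ ∼ ((x ∨ c) ⇒ (y ∨ c))
  negations⇔ = begin
    ∼ ((x ⇒ y) ∨ c)          ≡⟨ ∼-∨-deMorgan (x ⇒ y) c ⟩
    ∼ (x ⇒ y) ∧ ∼ c          ≈⟨ ∧-congʳ-⇔ (∼ c) (∼⇒⇔∧∼ x y) ⟩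
    (x ∧ ∼ y) ∧ ∼ c          ≡⟨ ∧-assoc x (∼ y) (∼ c) ⟩
    x ∧ (∼ y ∧ ∼ c)          ≈⟨ ∧-congʳ-⇔ (∼ y ∧ ∼ c) (∨-∧∼⇔ x z) ⟨
    (x ∨ c) ∧ (∼ y ∧ ∼ c)    ≡⟨ ≡.cong ((x ∨ c) ∧_) (∼-∨-deMorgan y c) ⟨
    (x ∨ c) ∧ ∼ (y ∨ c)      ≈⟨ ∼⇒⇔∧∼ (x ∨ c) (y ∨ c) ⟨
    ∼ ((x ∨ c) ⇒ (y ∨ c))    ∎
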